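{- Let $(X_n)_{n\in\mathbb{N}}$ be a branched $\mathbb{Z}_p$-tower of planar graphs, with a fixed planar embedding of each $X_n$, and assume that the dual graphs $(X_n^\vee)_{n\in\mathbb{N}}$ also form a branched $\mathbb{Z}_p$-tower over $X_0^\vee$. Let $\mathsf{v}_r$ and $\overline{\mathsf{v}}_r$ be the number of ramified vertices in the respective towers for $n\gg 0$. Then $0\le\mathsf{v}_r\le 2$ and $\overline{\mathsf{v}}_r=2-\mathsf{v}_r$.
   Context: A branched $\mathbb{Z}_p$-tower over a finite connected graph $X$ is a sequence $X=X_0\leftarrow X_1\leftarrow\cdots$ where $X_n$ is the derived graph with vertices $\bigsqcup_v\{v\}\times(\mathbb{Z}/p^n)/\pi_n(I_v)$ and directed edges $\mathbb{E}(X)\times\mathbb{Z}/p^n$, for a voltage assignment $\alpha\colon\mathbb{E}(X)\to\mathbb{Z}_p$ ($\alpha(\bar e)=-\alpha(e)$) and closed subgroups $I_v\subseteq\mathbb{Z}_p$, the edge $(e,g)$ running from $(o(e),g+\pi_n(I_{o(e)}))$ to $(t(e),g+\pi_n(\alpha(e))+\pi_n(I_{t(e)}))$; all $X_n$ are required to be connected. A vertex is ramified in the tower if the covering of the limit graph over that layer has ramification index greater than $1$ at a vertex above it (ramification index at $w$ = number of edges starting at $w$ mapping to a fixed edge starting at the image of $w$). The dual graph (for a fixed planar embedding) has a vertex for each face and an edge crossing each edge. -}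

module Defs where

open import Level using (0ℓ)
open import Data.Nat using (ℕ; zero; suc; _+_; _*_; _∸_; _^_; _≤_; _<_; _⊓_; NonZero)
open import Data.Nat.DivMod using (_%_; m%n<n)
open import Data.Nat.Properties using (m^n≢0)
open import Data.Fin using (Fin; toℕ; fromℕ<)
open import Data.Maybe using (Maybe; just; nothing)
open import Data.Product using (Σ; ∃; ∃-syntax; _×_; _,_; proj₁; proj₂)
open import Data.List using (List; length)
open import Data.List.Membership.Propositional using (_∈_)
open import Data.List.Relation.Unary.Unique.Propositional using (Unique)
open import Function.Bundles using (_↔_; _⇔_; Inverse)
open import Relation.Binary.PropositionalEquality using (_≡_; _≢_)

-- Graphs in the sense of Serre: vertices, directed edges, origin,
-- terminus, and a fixed-point-free involution e ↦ ē with t e = o ē.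

record Graph : Set₁ where
  field
    Vtx     : Set
    Edg     : Set
    o       : Edg → Vtx
    t       : Edg → Vtx
    bar     : Edg → Edg

open Graph public

record IsGraph (G : Graph) : Set where
  field
    bar-inv : ∀ e → bar G (bar G e) ≡ e
    bar-fix : ∀ e → bar G e ≢ e
    t-bar   : ∀ e → t G e ≡ o G (bar G e)


Finite : Set → Set
Finite A = Σ ℕ λ n → Fin n ↔ A

data Walk (G : Graph) : Vtx G → Vtx G → Set where
  nil  : ∀ x → Walk G x x
  cons : ∀ (e : Edg G) {y} → Walk G (t G e) y → Walk G (o G e) y

Connected : Graph → Set
Connected G = ∀ x y → Walk G x y

record Iso (G H : Graph) : Set where
  field
    vmap  : Vtx G ↔ Vtx H
    emap  : Edg G ↔ Edg H
    o-hom : ∀ e → Inverse.to vmap (o G e) ≡ o H (Inverse.to emap e)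
    t-hom : ∀ e → Inverse.to vmap (t G e) ≡ t H (Inverse.to emap e)
    bar-hom : ∀ e → Inverse.to emap (bar G e) ≡ bar H (Inverse.to emap e)

-- p-adic integers ℤ_p as compatible sequences of residues:
-- digits n ∈ {0,…,p^n - 1} is the image π_n(x) of x in ℤ/p^n.

modp : (p : ℕ) {{_ : NonZero p}} → ℕ → ℕ → ℕ
modp p n x = _%_ x (p ^ n) {{m^n≢0 p n}}

red : (p : ℕ) {{_ : NonZero p}} → (n : ℕ) → ℕ → Fin (p ^ n)
red p n x = fromℕ< (m%n<n x (p ^ n) {{m^n≢0 p n}})

record ℤₚ (p : ℕ) {{_ : NonZero p}} : Set where
  field
    res        : ℕ → ℕ
    res<       : ∀ n → res n < p ^ n
    res-compat : ∀ n → modp p n (res (suc n)) ≡ res n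

open ℤₚ public

πₙ : {p : ℕ} {{_ : NonZero p}} → ℕ → ℤₚ p → ℕ
πₙ n x = res x n

-- Closed subgroups of ℤ_p: these are exactly {0} and p^k ℤ_p (k ∈ ℕ).
-- We encode {0} as nothing and p^k ℤ_p as just k.

ClosedSubgroup : Set
ClosedSubgroup = Maybe ℕ

-- (ℤ/p^n)/π_n(I) ≅ ℤ/p^(lev I n)
lev : ClosedSubgroup → ℕ → ℕ
lev nothing  n = n
lev (just k) n = k ⊓ n

record Voltage (p : ℕ) {{_ : NonZero p}} (X : Graph) : Set where
  field
    α     : Edg X → ℤₚ p
    α-bar : ∀ e n → πₙ n (α (bar X e)) ≡ modp p n (p ^ n ∸ πₙ n (α e))

open Voltage public

-- The derived graph X_n of (X, α, (I_v)_v):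
--   vertices  ⊔_v {v} × (ℤ/p^n)/π_n(I_v),
--   edges     E(X) × ℤ/p^n,
--   (e,g) runs from (o e, g + π_n(I_{o e})) to (t e, g + π_n(α e) + π_n(I_{t e})),
--   and the reverse of (e,g) is (ē, g + π_n(α e)).

module _ (p : ℕ) {{_ : NonZero p}} (X : Graph) (V : Voltage p X)
         (I : Vtx X → ClosedSubgroup) where

  DVtx : ℕ → Set
  DVtx n = Σ (Vtx X) λ v → Fin (p ^ lev (I v) n)

  DEdg : ℕ → Set
  DEdg n = Edg X × Fin (p ^ n)

  Dbar : (n : ℕ) → DEdg n → DEdg n
  Dbar n (e , g) = bar X e , red p n (toℕ g + πₙ n (α V e))

  Do : (n : ℕ) → DEdg n → DVtx n
  Do n (e , g) = o X e , red p (lev (I (o X e)) n) (toℕ g)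

  Dt : (n : ℕ) → DEdg n → DVtx n
  Dt n (e , g) = t X e , red p (lev (I (t X e)) n) (toℕ g + πₙ n (α V e))

  Derived : ℕ → Graph
  Derived n = record { Vtx = DVtx n ; Edg = DEdg n ; o = Do n ; t = Dt n ; bar = Dbar n }

  projV : (m n : ℕ) → DVtx m → DVtx n
  projV m n (v , x) = v , red p (lev (I v) n) (toℕ x)

  projE : (m n : ℕ) → DEdg m → DEdg n
  projE m n (e , h) = e , red p n (toℕ h)

  -- A vertex w of X_n is ramified in the tower if the covering of the
  -- limit graph over X_n has ramification index > 1 at some vertex above w;
  -- since the index over X_n at the limit is the (monotone) limit of the
  -- indices of X_m → X_n, this means: for some m ≥ n, some vertex w' of X_m
  -- above w and some edge ε of X_n starting at w, at least two distinct
  -- edges of X_m starting at w' map to ε.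
  Ramified : (n : ℕ) → DVtx n → Set
  Ramified n w =
    ∃[ m ] (n ≤ m × ∃[ w' ] (projV m n w' ≡ w ×
      ∃[ ε ] (Do n ε ≡ w ×
        ∃[ ε₁ ] ∃[ ε₂ ] (ε₁ ≢ ε₂ ×
          Do m ε₁ ≡ w' × Do m ε₂ ≡ w' ×
          projE m n ε₁ ≡ ε × projE m n ε₂ ≡ ε))))

HasCount : {A : Set} → (A → Set) → ℕ → Set
HasCount {A} P c =
  Σ (List A) λ L → Unique L × (∀ x → (x ∈ L) ⇔ P x) × length L ≡ c

-- Planar embeddings, as genus-0 rotation systems (combinatorial maps).

iter : {A : Set} → (A → A) → ℕ → A → A
iter f zero    x = x
iter f (suc k) x = f (iter f k x)

record PlanarEmbedding (G : Graph) : Set where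
  private
    V = Vtx G
    E = Edg G
  field
    nV    : ℕ
    nE    : ℕ
    vfin  : Fin nV ↔ V
    efin  : Fin nE ↔ E
    -- rotation system: a permutation ρ of the directed edges whose cycles
    -- are exactly the sets of edges starting at each vertex (cyclic order
    -- around the vertex)
    ρ      : E → E
    ρ⁻¹    : E → E
    ρ-inv₁ : ∀ e → ρ (ρ⁻¹ e) ≡ e
    ρ-inv₂ : ∀ e → ρ⁻¹ (ρ e) ≡ e
    ρ-o    : ∀ e → o G (ρ e) ≡ o G e
    ρ-tr   : ∀ e e' → o G e ≡ o G e' → ∃[ k ] (iter ρ k e ≡ e')
    nF        : ℕ
    face      : E → Fin nF
    face-surj : ∀ f → ∃[ e ] (face e ≡ f)
    face-orb  : ∀ e e' → (face e ≡ face e') ⇔ (∃[ k ] (iter (λ d → ρ (bar G d)) k e ≡ e'))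
    -- genus 0 (Euler): |V| - |E|/2 + |F| = 2, |E| counting directed edges
    euler : 2 * nV + 2 * nF ≡ nE + 4

Dual : (G : Graph) → PlanarEmbedding G → Graph
Dual G P = record
  { Vtx = Fin (PlanarEmbedding.nF P)
  ; Edg = Edg G
  ; o   = λ e → PlanarEmbedding.face P e
  ; t   = λ e → PlanarEmbedding.face P (bar G e)
  ; bar = bar G
  }

{-# OPTIONS --safe #-}
-- For n large every inertia group I_v = p^k ℤ_p has stabilised: a vertex v of X then has
-- p^n vertices above it in X_n when I_v = 0, all unramified, and p^k when I_v = p^k ℤ_p,
-- all ramified (v carries an edge).  Hence |V(X_n)| = u p^n + v_r, likewise
-- |F(X_n)| = |V(X_n^∨)| = u' p^n + v̄_r, and |E(X_n)| = |E(X)| p^n.  Euler's formula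
-- 2|V| + 2|F| = |E| + 4 (directed edges) holds at the two levels n and n + 1, so the
-- constant terms agree: 2 (v_r + v̄_r) = 4.
module Submission where

open import Defs
open import Data.Empty using (⊥-elim)
open import Data.Fin using (Fin; zero; suc; toℕ; fromℕ<; inject≤)
open import Data.Fin.Properties
  using (_≟_; any?; injective⇒≤; cantor-schröder-bernstein; toℕ-injective; toℕ-fromℕ<; toℕ<n;
         toℕ-inject≤; inject≤-injective; +↔⊎; *↔×)
open import Data.List using (tabulate)
open import Data.List.Membership.Propositional using (_∈_)
open import Data.List.Membership.Propositional.Properties using (∈-tabulate⁺; ∈-tabulate⁻)
open import Data.List.Properties using (length-tabulate)
open import Data.List.Relation.Unary.Unique.Propositional.Properties using (tabulate⁺)
open import Data.Maybe using (just; nothing)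
open import Data.Nat using (ℕ; zero; suc; _+_; _*_; _∸_; _^_; _≤_; _<_; _⊔_; NonZero; >-nonZero; s≤s; nonTrivial⇒n>1)
open import Data.Nat.DivMod using (m<n⇒m%n≡m; [m+kn]%n≡m%n)
open import Data.Nat.Primality using (Prime; prime⇒nonTrivial)
open import Data.Nat.Properties
  using (+-*-semiring; +-commutativeSemigroup; ≤-refl; ≤-reflexive; ≤-trans; <-≤-trans; <⇒≤; <⇒≢; n<1+n; n≤1+n;
         m≤n⇒m≤1+n; m≤m+n; m≤n+m; m<m+n; m≤m⊔n; m≤n⊔m; m⊓n≤m; m⊓n≤n; m≤n⇒m⊓n≡m; ⊓-zeroʳ;
         +-comm; +-identityʳ; *-identityˡ; +-cancelˡ-≡; +-cancelʳ-≡; *-cancelˡ-≡; *-cancelʳ-≡;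
         m∸n+n≡m; m+[n∸m]≡n; m+n∸m≡n; m<n⇒0<n∸m; n<1⇒n≡0; +-monoˡ-<; *-monoˡ-≤;
         ^-monoʳ-≤; ^-monoʳ-<; ^-distribˡ-+-*; m^n≢0; m^n>0)
open import Data.Nat.Tactic.RingSolver using (solve-∀)
open import Data.Product using (Σ; ∃-syntax; _×_; _,_; proj₁; proj₂)
open import Data.Product.Function.Dependent.Propositional using (Σ-↔)
open import Data.Product.Function.NonDependent.Propositional using (_×-↔_)
open import Data.Product.Properties using (Σ-≡,≡←≡)
open import Data.Sum using (_⊎_; inj₁; inj₂; [_,_])
open import Data.Sum.Function.Propositional using (_⊎-↔_)
open import Data.Vec.Functional using (tail)
open import Function using (_∘_)
open import Function.Bundles using (_↔_; _⇔_; Inverse; Injection; mk⇔; mk↔ₛ′)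
open import Function.Construct.Composition using (_⇔-∘_)
open import Function.Construct.Symmetry using (⇔-sym)
open import Function.Definitions using (Injective)
open import Function.Properties.Inverse using (↔-refl; ↔-sym; ↔-trans; ↔⇒↣)
open import Relation.Binary.PropositionalEquality
  using (_≡_; _≢_; refl; sym; trans; cong; cong₂; subst; module ≡-Reasoning)
open import Relation.Nullary using (¬_; yes; no)
open import Relation.Nullary.Decidable using (via-injection)

open import Algebra.Properties.CommutativeSemigroup +-commutativeSemigroup using (interchange)
open import Algebra.Properties.Semiring.Sum +-*-semiring using (sum; sum-cong-≋; ∑-distrib-+; *-distribʳ-sum)

open ≡-Reasoning

↔-injective : {A B : Set} (e : A ↔ B) → Injective _≡_ _≡_ (Inverse.to e)
↔-injective e = Injection.injective (↔⇒↣ e)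

Fin-↔⇒≡ : ∀ {m n} → Fin m ↔ Fin n → m ≡ n
Fin-↔⇒≡ e = cantor-schröder-bernstein (↔-injective e) (↔-injective (↔-sym e))

Fin-↔-×⇒≡* : ∀ {A : Set} {c k m} → Fin c ↔ (A × Fin m) → Fin k ↔ A → c ≡ k * m
Fin-↔-×⇒≡* e fa = Fin-↔⇒≡ (↔-trans e (↔-trans (↔-sym fa ×-↔ ↔-refl) (↔-sym *↔×)))

¬Fin⇒≡0 : ∀ {n} → ¬ Fin n → n ≡ 0
¬Fin⇒≡0 {zero}  _    = refl
¬Fin⇒≡0 {suc _} ¬fin = ⊥-elim (¬fin zero)

Σ-Fin-suc↔ : ∀ {K} (B : Fin (suc K) → Set) → Σ (Fin (suc K)) B ↔ (B zero ⊎ Σ (Fin K) (B ∘ suc))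
Σ-Fin-suc↔ B = mk↔ₛ′
  (λ { (zero , b) → inj₁ b ; (suc i , b) → inj₂ (i , b) })
  [ (zero ,_) , (λ (i , b) → suc i , b) ]
  (λ { (inj₁ _) → refl ; (inj₂ _) → refl })
  (λ { (zero , _) → refl ; (suc _ , _) → refl })

Σ-Fin↔sum : ∀ {K} (h : Fin K → ℕ) → Σ (Fin K) (Fin ∘ h) ↔ Fin (sum h)
Σ-Fin↔sum {zero}  h = mk↔ₛ′ (λ { (() , _) }) (λ ()) (λ ()) (λ { (() , _) })
Σ-Fin↔sum {suc K} h =
  ↔-trans (Σ-Fin-suc↔ (Fin ∘ h)) (↔-trans (↔-refl ⊎-↔ Σ-Fin↔sum (tail h)) (↔-sym +↔⊎))

Σ-finite↔sum : ∀ {K} {A : Set} (e : Fin K ↔ A) (h : A → ℕ) →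
               Σ A (Fin ∘ h) ↔ Fin (sum (h ∘ Inverse.to e))
Σ-finite↔sum e h = ↔-trans (↔-sym (Σ-↔ e ↔-refl)) (Σ-Fin↔sum (h ∘ Inverse.to e))

sum-affine : ∀ {K} (a b c : Fin K → ℕ) x → (∀ i → c i ≡ a i * x + b i) → sum c ≡ sum a * x + sum b
sum-affine a b c x c≡ax+b = begin
  sum c                           ≡⟨ sum-cong-≋ c≡ax+b ⟩
  sum (λ i → a i * x + b i)       ≡⟨ ∑-distrib-+ (λ i → a i * x) b ⟩
  sum (λ i → a i * x) + sum b     ≡⟨ cong (_+ sum b) (*-distribʳ-sum x a) ⟨
  sum a * x + sum b               ∎

≤-sum : ∀ {K} (h : Fin K → ℕ) i → h i ≤ sum h
≤-sum h zero    = m≤m+n (h zero) _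
≤-sum h (suc i) = ≤-trans (≤-sum (tail h) i) (m≤n+m _ (h zero))

bounded-on-finite : ∀ {K} {A : Set} → Fin K ↔ A → (f : A → ℕ) → ∃[ N ] (∀ a → f a ≤ N)
bounded-on-finite e f = sum (f ∘ Inverse.to e) , λ a →
  subst (_≤ sum (f ∘ Inverse.to e)) (cong f (Inverse.strictlyInverseˡ e a)) (≤-sum _ (Inverse.from e a))

hasCount-image : {A B : Set} {P : A → Set} {c : ℕ} → Fin c ↔ B → (g : B → A) → Injective _≡_ _≡_ g →
                 (∀ a → P a ⇔ (∃[ b ] g b ≡ a)) → HasCount P c
hasCount-image {A} {c = c} e g g-inj P⇔image =
  tabulate enum , tabulate⁺ (↔-injective e ∘ g-inj) ,
  (λ a → ⇔-sym (P⇔image a) ⇔-∘ ∈⇔image a) , length-tabulate enum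
  where
  enum : Fin c → A
  enum = g ∘ Inverse.to e
  ∈⇔image : ∀ a → (a ∈ tabulate enum) ⇔ (∃[ b ] g b ≡ a)
  ∈⇔image a = mk⇔
    (λ a∈ → let (i , a≡) = ∈-tabulate⁻ a∈ in Inverse.to e i , sym a≡)
    (λ (b , gb≡a) → subst (_∈ tabulate enum) (trans (cong g (Inverse.strictlyInverseˡ e b)) gb≡a)
                          (∈-tabulate⁺ (Inverse.from e b)))

module _ {B : Set} {h g : B → ℕ} (h≤g : ∀ b → h b ≤ g b) where

  Σ-inject≤ : Σ B (Fin ∘ h) → Σ B (Fin ∘ g)
  Σ-inject≤ (b , y) = b , inject≤ y (h≤g b)

  Σ-inject≤-injective : Injective _≡_ _≡_ Σ-inject≤
  Σ-inject≤-injective {b , y} {_ , y′} eq with Σ-≡,≡←≡ eq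
  ... | refl , y≡y′ = cong (b ,_) (inject≤-injective _ _ y y′ y≡y′)

  Σ-inject≤-image : ∀ b (x : Fin (g b)) → (toℕ x < h b) ⇔ (∃[ s ] Σ-inject≤ s ≡ (b , x))
  Σ-inject≤-image b x = mk⇔
    (λ x<hb → (b , fromℕ< x<hb) , cong (b ,_) (toℕ-injective (trans (toℕ-inject≤ _ _) (toℕ-fromℕ< x<hb))))
    (λ { ((_ , y) , refl) → subst (_< h b) (sym (toℕ-inject≤ y _)) (toℕ<n y) })

affine-slope-unique : ∀ a c x s .{{_ : NonZero s}} → a * x + c * (x + s) ≡ c * x + a * (x + s) → a ≡ c
affine-slope-unique a c x s eq = sym (*-cancelʳ-≡ c a s (+-cancelˡ-≡ (a * x + c * x) _ _ (begin
  (a * x + c * x) + c * s   ≡⟨ expand a c x s ⟩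
  a * x + c * (x + s)       ≡⟨ eq ⟩
  c * x + a * (x + s)       ≡⟨ expand c a x s ⟨
  (c * x + a * x) + a * s   ≡⟨ cong (_+ a * s) (+-comm (c * x) (a * x)) ⟩
  (a * x + c * x) + a * s   ∎)))
  where
  expand : ∀ a c x s → (a * x + c * x) + c * s ≡ a * x + c * (x + s)
  expand = solve-∀

affine-intercept-unique : ∀ {x y} a b c d → x < y → a * x + b ≡ c * x + d → a * y + b ≡ c * y + d → b ≡ d
affine-intercept-unique {x} {y} a b c d x<y at-x at-y =
  +-cancelˡ-≡ (a * x) b d (trans at-x (cong (λ z → z * x + d) (sym a≡c)))
  where
  cross : a * x + c * y ≡ c * x + a * y
  cross = +-cancelʳ-≡ (b + d) _ _ (begin
    (a * x + c * y) + (b + d)   ≡⟨ interchange (a * x) (c * y) b d ⟩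
    (a * x + b) + (c * y + d)   ≡⟨ cong₂ _+_ at-x (sym at-y) ⟩
    (c * x + d) + (a * y + b)   ≡⟨ interchange (c * x) d (a * y) b ⟩
    (c * x + a * y) + (d + b)   ≡⟨ cong (c * x + a * y +_) (+-comm d b) ⟩
    (c * x + a * y) + (b + d)   ∎)
  a≡c : a ≡ c
  a≡c = affine-slope-unique a c x (y ∸ x) {{>-nonZero (m<n⇒0<n∸m x<y)}}
          (subst (λ z → a * x + c * z ≡ c * x + a * z) (sym (m+[n∸m]≡n (<⇒≤ x<y))) cross)

levelBound : ClosedSubgroup → ℕ
levelBound nothing  = 0
levelBound (just k) = k

unramifiedPart : ClosedSubgroup → ℕ
unramifiedPart nothing  = 1
unramifiedPart (just _) = 0

lev≤ : ∀ J n → lev J n ≤ n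
lev≤ nothing  n = ≤-refl
lev≤ (just k) n = m⊓n≤n k n

lev≤levelBound : ∀ {J k} n → J ≡ just k → lev J n ≤ k
lev≤levelBound {k = k} n refl = m⊓n≤m k n

lev-stable : ∀ {J k n} → J ≡ just k → k ≤ n → lev J n ≡ k
lev-stable refl k≤n = m≤n⇒m⊓n≡m k≤n

lev-zero : ∀ J → lev J 0 ≡ 0
lev-zero nothing  = refl
lev-zero (just k) = ⊓-zeroʳ k

prime⇒2≤ : ∀ {p} → Prime p → 2 ≤ p
prime⇒2≤ {p} pr = nonTrivial⇒n>1 p {{prime⇒nonTrivial pr}}

module _ (p : ℕ) {{_ : NonZero p}} where

  modp-small : ∀ j {a} → a < p ^ j → modp p j a ≡ a
  modp-small j = m<n⇒m%n≡m {{m^n≢0 p j}}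

  modp-+-pow : ∀ {j q a} → j ≤ q → a < p ^ j → modp p j (a + p ^ q) ≡ a
  modp-+-pow {j} {q} {a} j≤q a<pʲ = begin
    modp p j (a + p ^ q)                 ≡⟨ cong (λ z → modp p j (a + p ^ z)) (m∸n+n≡m j≤q) ⟨
    modp p j (a + p ^ (q ∸ j + j))       ≡⟨ cong (λ z → modp p j (a + z)) (^-distribˡ-+-* p (q ∸ j) j) ⟩
    modp p j (a + p ^ (q ∸ j) * p ^ j)   ≡⟨ [m+kn]%n≡m%n a (p ^ (q ∸ j)) (p ^ j) {{m^n≢0 p j}} ⟩
    modp p j a                           ≡⟨ modp-small j a<pʲ ⟩
    a                                    ∎

  +-pow-< : 2 ≤ p → ∀ {a} q → a < p ^ q → a + p ^ q < p ^ suc q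
  +-pow-< p≥2 q a<pᵠ = <-≤-trans (+-monoˡ-< (p ^ q) a<pᵠ)
    (subst (_≤ p * p ^ q) (cong (p ^ q +_) (+-identityʳ (p ^ q))) (*-monoˡ-≤ (p ^ q) p≥2))

  red-fromℕ< : ∀ j {b c} (b<c : b < c) {y : Fin (p ^ j)} → modp p j b ≡ toℕ y →
               red p j (toℕ (fromℕ< b<c)) ≡ y
  red-fromℕ< j {b} b<c {y} b≡y = toℕ-injective (begin
    toℕ (red p j (toℕ (fromℕ< b<c)))    ≡⟨ toℕ-fromℕ< _ ⟩
    modp p j (toℕ (fromℕ< b<c))         ≡⟨ cong (modp p j) (toℕ-fromℕ< b<c) ⟩
    modp p j b                          ≡⟨ b≡y ⟩
    toℕ y                               ∎)

  toℕ-red-unramified : ∀ {J} → J ≡ nothing → ∀ {m} (g : Fin (p ^ m)) → toℕ (red p (lev J m) (toℕ g)) ≡ toℕ g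
  toℕ-red-unramified refl {m} g = trans (toℕ-fromℕ< _) (modp-small m (toℕ<n g))

  level₀-fibre-trivial : ∀ J (x y : Fin (p ^ lev J 0)) → x ≡ y
  level₀-fibre-trivial J x y = toℕ-injective (trans (toℕ≡0 x) (sym (toℕ≡0 y)))
    where
    toℕ≡0 : (z : Fin (p ^ lev J 0)) → toℕ z ≡ 0
    toℕ≡0 z = n<1⇒n≡0 (subst (λ j → toℕ z < p ^ j) (lev-zero J) (toℕ<n z))

  ramifiedPart : ClosedSubgroup → ℕ
  ramifiedPart nothing  = 0
  ramifiedPart (just k) = p ^ k

  fibreSize-split : ∀ J {n} → levelBound J ≤ n → p ^ lev J n ≡ unramifiedPart J * p ^ n + ramifiedPart J
  fibreSize-split nothing  _   = sym (trans (+-identityʳ _) (*-identityˡ _))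
  fibreSize-split (just k) k≤n = cong (p ^_) (lev-stable refl k≤n)

  ramifiedPart≤fibreSize : ∀ J {n} → levelBound J ≤ n → ramifiedPart J ≤ p ^ lev J n
  ramifiedPart≤fibreSize J bound = subst (ramifiedPart J ≤_) (sym (fibreSize-split J bound)) (m≤n+m _ _)

  toℕ<ramifiedPart : ∀ J {n} → levelBound J ≤ n → J ≢ nothing → (x : Fin (p ^ lev J n)) → toℕ x < ramifiedPart J
  toℕ<ramifiedPart nothing  _   J≢∅ _ = ⊥-elim (J≢∅ refl)
  toℕ<ramifiedPart (just k) k≤n _   x = subst (λ j → toℕ x < p ^ j) (lev-stable refl k≤n) (toℕ<n x)

  <ramifiedPart⇒just : ∀ {J a} → a < ramifiedPart J → ∃[ k ] J ≡ just k
  <ramifiedPart⇒just {just k} _ = k , refl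

module _ (p : ℕ) {{_ : NonZero p}} {Y : Graph} (V : Voltage p Y) (I : Vtx Y → ClosedSubgroup) where

  unramified-edges-unique : ∀ {m e₁ e₂} {g₁ g₂ : Fin (p ^ m)} → I (o Y e₁) ≡ nothing →
                            Do p Y V I m (e₁ , g₁) ≡ Do p Y V I m (e₂ , g₂) → e₁ ≡ e₂ →
                            _≡_ {A = DEdg p Y V I m} (e₁ , g₁) (e₂ , g₂)
  unramified-edges-unique {e₁ = e} {g₁ = g₁} {g₂} Ie≡∅ same-origin refl = cong (e ,_) (toℕ-injective (begin
    toℕ g₁                                       ≡⟨ toℕ-red-unramified p Ie≡∅ g₁ ⟨
    toℕ (red p (lev (I (o Y e)) _) (toℕ g₁))     ≡⟨ cong (λ w → toℕ (proj₂ w)) same-origin ⟩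
    toℕ (red p (lev (I (o Y e)) _) (toℕ g₂))     ≡⟨ toℕ-red-unramified p Ie≡∅ g₂ ⟩
    toℕ g₂                                       ∎))

  unramified : ∀ {v n} {x : Fin (p ^ lev (I v) n)} → I v ≡ nothing → ¬ Ramified p Y V I n (v , x)
  unramified Iv≡∅ (_ , _ , _ , w′↦w , _ , _ , (e₁ , _) , _ , ε₁≢ε₂ , ε₁-at-w′ , ε₂-at-w′ , ε₁↦ε , ε₂↦ε) =
    ε₁≢ε₂ (unramified-edges-unique Ie₁≡∅ (trans ε₁-at-w′ (sym ε₂-at-w′)) (cong proj₁ (trans ε₁↦ε (sym ε₂↦ε))))
    where
    Ie₁≡∅ : I (o Y e₁) ≡ nothing
    Ie₁≡∅ = trans (cong I (trans (cong proj₁ ε₁-at-w′) (cong proj₁ w′↦w))) Iv≡∅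

  -- The edges (e, a) and (e, a + p^q) of X_{q+1} start at the same vertex, since the fibre
  -- there has level k ≤ q, and lie over the same edge of X_n.
  ramified : 2 ≤ p → ∀ e {k} → I (o Y e) ≡ just k → ∀ {n} (x : Fin (p ^ lev (I (o Y e)) n)) →
             Ramified p Y V I n (o Y e , x)
  ramified p≥2 e {k} Ie≡k {n} x =
    m , m≤n⇒m≤1+n (m≤m+n n k) , (o Y e , fromℕ< a<pᴶᵐ) , lies-over-x a<pᴶᵐ , ε , lies-over-x a<pⁿ ,
    ε₁ , ε₂ , ε₁≢ε₂ ,
    cong (o Y e ,_) (onto (lev J m) a<pᵐ a<pᴶᵐ (modp-small p (lev J m) a<pᴶᵐ)) ,
    cong (o Y e ,_) (onto (lev J m) a+pᵠ<pᵐ a<pᴶᵐ (modp-+-pow p (≤-trans (≤-reflexive levJm≡k) (m≤n+m k n)) a<pᴶᵐ)) ,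
    cong (e ,_) (onto n a<pᵐ a<pⁿ (modp-small p n a<pⁿ)) ,
    cong (e ,_) (onto n a+pᵠ<pᵐ a<pⁿ (modp-+-pow p (m≤m+n n k) a<pⁿ))
    where
    J : ClosedSubgroup
    J = I (o Y e)
    a q m : ℕ
    a = toℕ x
    q = n + k
    m = suc q
    levJm≡k : lev J m ≡ k
    levJm≡k = lev-stable Ie≡k (m≤n⇒m≤1+n (m≤n+m k n))
    a<pᵏ : a < p ^ k
    a<pᵏ = <-≤-trans (toℕ<n x) (^-monoʳ-≤ p (lev≤levelBound n Ie≡k))
    a<pⁿ : a < p ^ n
    a<pⁿ = <-≤-trans (toℕ<n x) (^-monoʳ-≤ p (lev≤ J n))
    a<pᴶᵐ : a < p ^ lev J m
    a<pᴶᵐ = subst (λ j → a < p ^ j) (sym levJm≡k) a<pᵏ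
    a<pᵐ : a < p ^ m
    a<pᵐ = <-≤-trans a<pᵏ (^-monoʳ-≤ p (m≤n⇒m≤1+n (m≤n+m k n)))
    a+pᵠ<pᵐ : a + p ^ q < p ^ m
    a+pᵠ<pᵐ = +-pow-< p p≥2 q (<-≤-trans a<pᵏ (^-monoʳ-≤ p (m≤n+m k n)))
    onto : ∀ j {b c} (b<c : b < c) (a<pʲ : a < p ^ j) → modp p j b ≡ a → red p j (toℕ (fromℕ< b<c)) ≡ fromℕ< a<pʲ
    onto j b<c a<pʲ b≡a = red-fromℕ< p j b<c (trans b≡a (sym (toℕ-fromℕ< a<pʲ)))
    lies-over-x : ∀ {c} (a<c : a < c) →
                  _≡_ {A = DVtx p Y V I n} (o Y e , red p (lev J n) (toℕ (fromℕ< a<c))) (o Y e , x)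
    lies-over-x a<c = cong (o Y e ,_) (red-fromℕ< p (lev J n) a<c (modp-small p (lev J n) (toℕ<n x)))
    ε : DEdg p Y V I n
    ε = e , fromℕ< a<pⁿ
    ε₁ ε₂ : DEdg p Y V I m
    ε₁ = e , fromℕ< a<pᵐ
    ε₂ = e , fromℕ< a+pᵠ<pᵐ
    ε₁≢ε₂ : ε₁ ≢ ε₂
    ε₁≢ε₂ ε₁≡ε₂ = <⇒≢ (m<m+n a (m^n>0 p q)) (begin
      a                        ≡⟨ toℕ-fromℕ< a<pᵐ ⟨
      toℕ (fromℕ< a<pᵐ)        ≡⟨ cong (λ ε′ → toℕ (proj₂ ε′)) ε₁≡ε₂ ⟩
      toℕ (fromℕ< a+pᵠ<pᵐ)     ≡⟨ toℕ-fromℕ< a+pᵠ<pᵐ ⟩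
      a + p ^ q                ∎)

  ramified⇔ : 2 ≤ p → ∀ {v n} → ∃[ e ] o Y e ≡ v → levelBound (I v) ≤ n → (x : Fin (p ^ lev (I v) n)) →
              Ramified p Y V I n (v , x) ⇔ (toℕ x < ramifiedPart p (I v))
  ramified⇔ p≥2 (e , refl) bound x = mk⇔
    (λ r → toℕ<ramifiedPart p (I (o Y e)) bound (λ Ie≡∅ → unramified Ie≡∅ r) x)
    (λ x<r → ramified p≥2 e (proj₂ (<ramifiedPart⇒just p x<r)) x)

  vertexCount : ∀ {K nV n} (fv : Fin K ↔ Vtx Y) → Fin nV ↔ DVtx p Y V I n → (∀ v → levelBound (I v) ≤ n) →
                nV ≡ sum (unramifiedPart ∘ I ∘ Inverse.to fv) * p ^ n + sum (ramifiedPart p ∘ I ∘ Inverse.to fv)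
  vertexCount {n = n} fv fn bound = trans (Fin-↔⇒≡ (↔-trans fn (Σ-finite↔sum fv (λ v → p ^ lev (I v) n))))
    (sum-affine _ _ _ (p ^ n) (λ i → fibreSize-split p (I (Inverse.to fv i)) (bound (Inverse.to fv i))))

  ramifiedCount : 2 ≤ p → ∀ {K n} (fv : Fin K ↔ Vtx Y) → (∀ v → ∃[ e ] o Y e ≡ v) →
                  (∀ v → levelBound (I v) ≤ n) →
                  HasCount (Ramified p Y V I n) (sum (ramifiedPart p ∘ I ∘ Inverse.to fv))
  ramifiedCount p≥2 {n = n} fv outgoing bound =
    hasCount-image (↔-sym (Σ-finite↔sum fv (ramifiedPart p ∘ I))) (Σ-inject≤ r≤f) (Σ-inject≤-injective r≤f)
      (λ (v , x) → Σ-inject≤-image r≤f v x ⇔-∘ ramified⇔ p≥2 (outgoing v) (bound v) x)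
    where
    r≤f : ∀ v → ramifiedPart p (I v) ≤ p ^ lev (I v) n
    r≤f v = ramifiedPart≤fibreSize p (I v) (bound v)

  vertexCount-eventually-affine :
    2 ≤ p → ∀ {K} → Fin K ↔ Vtx Y → (∀ v → ∃[ e ] o Y e ≡ v) →
    ∃[ u ] ∃[ r ] ∃[ N ] ∀ n → N ≤ n →
      (∀ {nV} → Fin nV ↔ DVtx p Y V I n → nV ≡ u * p ^ n + r) × HasCount (Ramified p Y V I n) r
  vertexCount-eventually-affine p≥2 fv outgoing with bounded-on-finite fv (levelBound ∘ I)
  ... | N , N-bound =
    sum (unramifiedPart ∘ I ∘ Inverse.to fv) , sum (ramifiedPart p ∘ I ∘ Inverse.to fv) , N ,
    λ n N≤n → (λ fn → vertexCount fv fn (bound N≤n)) , ramifiedCount p≥2 fv outgoing (bound N≤n)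
    where
    bound : ∀ {n} → N ≤ n → ∀ v → levelBound (I v) ≤ n
    bound N≤n v = ≤-trans (N-bound v) N≤n

walk-trivial-or-leaves : ∀ {G : Graph} {a b} → Walk G a b → a ≡ b ⊎ ∃[ e ] o G e ≡ a
walk-trivial-or-leaves (nil _)    = inj₁ refl
walk-trivial-or-leaves (cons e _) = inj₂ (e , refl)

-- Faces are orbits of directed edges, so an edgeless graph has no faces.
edgeless-embedding-has-two-vertices : ∀ {G} (P : PlanarEmbedding G) → ¬ Edg G → PlanarEmbedding.nV P ≡ 2
edgeless-embedding-has-two-vertices P edgeless = *-cancelˡ-≡ nV 2 2 (begin
  2 * nV               ≡⟨ +-identityʳ (2 * nV) ⟨
  2 * nV + 2 * 0       ≡⟨ cong (λ f → 2 * nV + 2 * f) nF≡0 ⟨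
  2 * nV + 2 * nF      ≡⟨ euler ⟩
  nE + 4               ≡⟨ cong (_+ 4) nE≡0 ⟩
  4                    ∎)
  where
  open PlanarEmbedding P
  nE≡0 : nE ≡ 0
  nE≡0 = ¬Fin⇒≡0 (edgeless ∘ Inverse.to efin)
  nF≡0 : nF ≡ 0
  nF≡0 = ¬Fin⇒≡0 (edgeless ∘ proj₁ ∘ face-surj)

-- An isolated vertex v of the connected graph X is its only vertex, so X_0 would be a
-- single vertex without edges, which has no planar embedding in the above sense.
has-outgoing-edge : ∀ p {{_ : NonZero p}} {X : Graph} → Finite (Vtx X) → Finite (Edg X) → Connected X →
                    (α : Voltage p X) (I : Vtx X → ClosedSubgroup) → PlanarEmbedding (Derived p X α I 0) →
                    ∀ v → ∃[ e ] o X e ≡ v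
has-outgoing-edge p {X} (_ , fv) (_ , fe) conn α I P v
  with any? (λ i → via-injection (↔⇒↣ (↔-sym fv)) _≟_ (o X (Inverse.to fe i)) v)
... | yes (i , oe≡v) = Inverse.to fe i , oe≡v
... | no none = ⊥-elim (2≰1 (subst (_≤ 1) (edgeless-embedding-has-two-vertices P edgeless₀) nV≤1))
  where
  isolated : ∀ e → o X e ≢ v
  isolated e oe≡v = none (Inverse.from fe e , trans (cong (o X) (Inverse.strictlyInverseˡ fe e)) oe≡v)
  only-v : ∀ u → u ≡ v
  only-v u = [ sym , (λ (e , oe≡v) → ⊥-elim (isolated e oe≡v)) ] (walk-trivial-or-leaves (conn v u))
  edgeless₀ : ¬ DEdg p X α I 0
  edgeless₀ (e , _) = isolated e (only-v (o X e))
  singleton₀ : (w w′ : DVtx p X α I 0) → w ≡ w′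
  singleton₀ (u , x) (u′ , x′) with trans (only-v u) (sym (only-v u′))
  ... | refl = cong (u ,_) (level₀-fibre-trivial p (I u) x x′)
  nV≤1 : PlanarEmbedding.nV P ≤ 1
  nV≤1 = injective⇒≤ {f = λ _ → zero} (λ _ → ↔-injective (PlanarEmbedding.vfin P) (singleton₀ _ _))
  2≰1 : ¬ 2 ≤ 1
  2≰1 (s≤s ())

euler-affine : ∀ {G} (P : PlanarEmbedding G) x u u′ r r′ E →
               PlanarEmbedding.nV P ≡ u * x + r → PlanarEmbedding.nF P ≡ u′ * x + r′ →
               PlanarEmbedding.nE P ≡ E * x → 2 * (u + u′) * x + 2 * (r + r′) ≡ E * x + 4
euler-affine P x u u′ r r′ E vertices faces edges = begin
  2 * (u + u′) * x + 2 * (r + r′)           ≡⟨ regroup u u′ r r′ x ⟩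
  2 * (u * x + r) + 2 * (u′ * x + r′)       ≡⟨ cong₂ (λ a b → 2 * a + 2 * b) vertices faces ⟨
  2 * nV + 2 * nF                           ≡⟨ euler ⟩
  nE + 4                                    ≡⟨ cong (_+ 4) edges ⟩
  E * x + 4                                 ∎
  where
  open PlanarEmbedding P using (nV; nF; nE; euler)
  regroup : ∀ u u′ r r′ x → 2 * (u + u′) * x + 2 * (r + r′) ≡ 2 * (u * x + r) + 2 * (u′ * x + r′)
  regroup = solve-∀

corollary5p4 :
    (p : ℕ) {{nz : NonZero p}} → Prime p →
    (X : Graph) → IsGraph X → Finite (Vtx X) → Finite (Edg X) → Connected X →
    (α : Voltage p X) (I : Vtx X → ClosedSubgroup) →
    (∀ n → Connected (Derived p X α I n)) →
    (emb : (n : ℕ) → PlanarEmbedding (Derived p X α I n)) →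
    (α' : Voltage p (Dual (Derived p X α I 0) (emb 0)))
    (I' : Vtx (Dual (Derived p X α I 0) (emb 0)) → ClosedSubgroup) →
    (∀ n → Connected (Derived p (Dual (Derived p X α I 0) (emb 0)) α' I' n)) →
    (∀ n → Iso (Derived p (Dual (Derived p X α I 0) (emb 0)) α' I' n)
               (Dual (Derived p X α I n) (emb n))) →
    ∃[ vr ] ∃[ vr̄ ] ∃[ N ]
      ((∀ n → N ≤ n →
          HasCount (Ramified p X α I n) vr
          × HasCount (Ramified p (Dual (Derived p X α I 0) (emb 0)) α' I' n) vr̄)
       × vr ≤ 2 × vr̄ ≡ 2 ∸ vr)
corollary5p4 p pr X _ (K , fv) (E , fe) conn α I _ emb α′ I′ _ iso
  with vertexCount-eventually-affine p α I (prime⇒2≤ pr) fv (has-outgoing-edge p (K , fv) (E , fe) conn α I (emb 0))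
     | vertexCount-eventually-affine p α′ I′ (prime⇒2≤ pr) ↔-refl (PlanarEmbedding.face-surj (emb 0))
... | u , r , N , stable | u′ , r′ , N′ , stable′ =
  r , r′ , M , (λ n M≤n → proj₂ (stable n (N≤ M≤n)) , proj₂ (stable′ n (N′≤ M≤n))) ,
  subst (r ≤_) r+r′≡2 (m≤m+n r r′) , trans (sym (m+n∸m≡n r r′)) (cong (_∸ r) r+r′≡2)
  where
  M : ℕ
  M = N ⊔ N′
  N≤ : ∀ {n} → M ≤ n → N ≤ n
  N≤ = ≤-trans (m≤m⊔n N N′)
  N′≤ : ∀ {n} → M ≤ n → N′ ≤ n
  N′≤ = ≤-trans (m≤n⊔m N N′)
  euler : ∀ n → M ≤ n → 2 * (u + u′) * p ^ n + 2 * (r + r′) ≡ E * p ^ n + 4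
  euler n M≤n = euler-affine (emb n) (p ^ n) u u′ r r′ E
    (proj₁ (stable n (N≤ M≤n)) (PlanarEmbedding.vfin (emb n)))
    (proj₁ (stable′ n (N′≤ M≤n)) (↔-sym (Iso.vmap (iso n))))
    (Fin-↔-×⇒≡* (PlanarEmbedding.efin (emb n)) fe)
  r+r′≡2 : r + r′ ≡ 2
  r+r′≡2 = *-cancelˡ-≡ (r + r′) 2 2 (affine-intercept-unique (2 * (u + u′)) _ E 4
    (^-monoʳ-< p (prime⇒2≤ pr) (n<1+n M)) (euler M ≤-refl) (euler (suc M) (n≤1+n M)))
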